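{- Let $T'=(N'_1,\ldots,N'_t)$ be any problem instance of $t$ CPTs for $V_n$ such that each of the $2^t$ vectors in $\{0,1\}^t$ is the voting configuration of $T'$ for exactly one swap, and let $N$ be an optimal solution for $T'$. Then $$f_{T'}(N)=\begin{cases} 2\sum_{\kappa=0}^{c-1}\kappa\binom{2c-1}{\kappa} & \text{if } t=2c-1,\\ 2\sum_{\kappa=0}^{c-1}\kappa\binom{2c}{\kappa}+c\binom{2c}{c} & \text{if } t=2c.\end{cases}$$
   Context: Binary attributes $V_1,\ldots,V_n$, each with domain $\{0,1\}$. For $Q\subseteq\{V_1,\ldots,V_{n-1}\}$, $\mathrm{Inst}(Q)$ is the set of assignments of values in $\{0,1\}$ to the attributes of $Q$. A (complete) CPT $N$ for $V_n$ consists of a parent set $Pa(N,V_n)\subseteq\{V_1,\ldots,V_{n-1}\}$ and, for each $\gamma\in\mathrm{Inst}(Pa(N,V_n))$, exactly one rule, either $\gamma:0\succ 1$ or $\gamma:1\succ 0$. A swap over $V_n$ is identified with an element $x\in\{0,1\}^{n-1}$; the vote of $N$ on $x$ is $0$ if the rule of $N$ whose context agrees with $x$ on $Pa(N,V_n)$ is of the form $\gamma:0\succ1$, and $1$ otherwise. $\Delta(N,N')$ is the number of swaps on which $N,N'$ vote differently. For a problem instance $T=(N_1,\ldots,N_t)$ (tuple of CPTs for $V_n$), $f_T(N)=\sum_{s=1}^t\Delta(N,N_s)$, and an optimal solution for $T$ is a CPT for $V_n$ (any parent set $\subseteq\{V_1,\ldots,V_{n-1}\}$) minimizing $f_T$.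 The voting configuration of $T$ for swap $x$ is the vector $(v_1,\ldots,v_t)\in\{0,1\}^t$ where $v_s$ is the vote of $N_s$ on $x$. -}

module Defs where

open import Data.Nat using (ℕ; zero; suc; _+_; _*_; _≤_)
open import Data.Bool using (Bool; true; false; _≟_)
open import Data.Fin using (Fin)
open import Data.Fin.Subset using (Subset; _∈_)
open import Data.Vec using (Vec; []; _∷_; lookup; map)
open import Data.List using (List; []; _∷_; length; filter; _++_)
import Data.List as L
open import Relation.Nullary using (¬_; Dec; yes; no)
open import Relation.Nullary.Decidable using (¬?)

-- m = n - 1 is the number of attributes V_1..V_{n-1}; attribute V_{i+1} is index i : Fin m.
-- Value 0 is false, value 1 is true.

Inst : {m : ℕ} → Subset m → Set
Inst {m} P = (i : Fin m) → i ∈ P → Bool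

-- A complete CPT for V_n: parent set plus exactly one rule per instantiation
-- of the parent set.  rule γ = false means "γ : 0 ≻ 1", true means "γ : 1 ≻ 0".
record CPT (m : ℕ) : Set where
  field
    parents : Subset m
    rule    : Inst parents → Bool
open CPT public

Swap : ℕ → Set
Swap m = Vec Bool m

vote : {m : ℕ} → CPT m → Swap m → Bool
vote N x = rule N (λ i _ → lookup x i)

allSwaps : (m : ℕ) → List (Swap m)
allSwaps zero = [] ∷ []
allSwaps (suc m) = L.map (false ∷_) (allSwaps m) ++ L.map (true ∷_) (allSwaps m)

Δ : {m : ℕ} → CPT m → CPT m → ℕ
Δ {m} N N' = length (filter (λ x → ¬? (vote N x ≟ vote N' x)) (allSwaps m))

Instance : ℕ → ℕ → Set
Instance m t = Vec (CPT m) t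

f : {m t : ℕ} → Instance m t → CPT m → ℕ
f [] N = 0
f (Ns ∷ T) N = Δ N Ns + f T N

Optimal : {m t : ℕ} → Instance m t → CPT m → Set
Optimal {m} T N = (N' : CPT m) → f T N ≤ f T N'

config : {m t : ℕ} → Instance m t → Swap m → Vec Bool t
config T x = map (λ Ns → vote Ns x) T

-- An optimal CPT can do no better, on each swap x, than the minority of the t
-- votes on x, and the CPT with all attributes as parents that follows the
-- majority on every swap attains this; so f_{T'}(N) is the sum over all swaps
-- of min(k, t − k), k being the number of 1-votes.  Since the voting
-- configuration is a bijection from swaps onto {0,1}^t, this is the sum over
-- all of {0,1}^t, i.e. Σ_k C(t,k) min(k, t − k), and the symmetry
-- C(t,k) = C(t,t−k) folds the upper half of that sum onto the lower half.
module Submission where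

open import Defs
open import Data.Nat using (ℕ; _+_; _*_; _∸_)
open import Data.Nat.Combinatorics using (_C_)
open import Data.Bool using (Bool)
open import Data.Vec using (Vec)
open import Data.List using (map; upTo)
open import Data.Nat.ListAction using (sum)
open import Data.Product using (Σ; _×_)
open import Relation.Binary.PropositionalEquality using (_≡_)

open import Data.Nat using (zero; suc; _≤_; _<_; _⊓_; z≤n; s≤s; s≤s⁻¹; _≤?_)
open import Data.Nat.Properties
open import Data.Nat.Combinatorics using (k>n⇒nCk≡0; nCk+nC[k+1]≡[n+1]C[k+1]; nCk≡nC[n∸k])
open import Algebra.Properties.CommutativeSemigroup +-commutativeSemigroup using (interchange)
open import Data.Bool using (true; false; if_then_else_) renaming (_≟_ to _≟ᵇ_)
open import Data.Vec using ([]; _∷_; tabulate)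
open import Data.Vec.Properties using (tabulate∘lookup; ≡-dec)
open import Data.List using (List; []; _∷_; _++_; length; filter; applyUpTo)
open import Data.Fin.Subset using (⊤)
open import Data.Fin.Subset.Properties using (∈⊤)
open import Data.Product using (_,_)
open import Data.Empty using (⊥-elim)
open import Relation.Nullary using (Dec; yes; no; does; ¬?)
open import Relation.Binary.PropositionalEquality using (refl; sym; trans; cong; cong₂; subst)
open Relation.Binary.PropositionalEquality.≡-Reasoning

private variable
  A B : Set
  m t : ℕ

∑ : List A → (A → ℕ) → ℕ
∑ []       g = 0
∑ (x ∷ xs) g = g x + ∑ xs g

syntax ∑ xs (λ x → e) = ∑[ x ∈ xs ] e

∑-cong : (xs : List A) {g h : A → ℕ} → (∀ x → g x ≡ h x) → ∑ xs g ≡ ∑ xs h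
∑-cong []       g≡h = refl
∑-cong (x ∷ xs) g≡h = cong₂ _+_ (g≡h x) (∑-cong xs g≡h)

∑-mono-≤ : (xs : List A) {g h : A → ℕ} → (∀ x → g x ≤ h x) → ∑ xs g ≤ ∑ xs h
∑-mono-≤ []       g≤h = z≤n
∑-mono-≤ (x ∷ xs) g≤h = +-mono-≤ (g≤h x) (∑-mono-≤ xs g≤h)

∑-zero : (xs : List A) → ∑[ x ∈ xs ] 0 ≡ 0
∑-zero []       = refl
∑-zero (x ∷ xs) = ∑-zero xs

∑-distrib-+ : (xs : List A) (g h : A → ℕ) → ∑[ x ∈ xs ] (g x + h x) ≡ ∑ xs g + ∑ xs h
∑-distrib-+ []       g h = refl
∑-distrib-+ (x ∷ xs) g h =
  trans (cong (g x + h x +_) (∑-distrib-+ xs g h)) (interchange (g x) (h x) (∑ xs g) (∑ xs h))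

∑-distribʳ-* : (xs : List A) (g : A → ℕ) (c : ℕ) → ∑[ x ∈ xs ] (g x * c) ≡ ∑ xs g * c
∑-distribʳ-* []       g c = refl
∑-distribʳ-* (x ∷ xs) g c =
  trans (cong (g x * c +_) (∑-distribʳ-* xs g c)) (sym (*-distribʳ-+ c (g x) (∑ xs g)))

∑-comm : (xs : List A) (ys : List B) (k : A → B → ℕ)
       → ∑[ x ∈ xs ] ∑[ y ∈ ys ] k x y ≡ ∑[ y ∈ ys ] ∑[ x ∈ xs ] k x y
∑-comm []       ys k = sym (∑-zero ys)
∑-comm (x ∷ xs) ys k =
  trans (cong (∑ ys (k x) +_) (∑-comm xs ys k)) (sym (∑-distrib-+ ys (k x) (λ y → ∑[ x ∈ xs ] k x y)))

∑-++ : (xs ys : List A) (g : A → ℕ) → ∑ (xs ++ ys) g ≡ ∑ xs g + ∑ ys g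
∑-++ []       ys g = refl
∑-++ (x ∷ xs) ys g = trans (cong (g x +_) (∑-++ xs ys g)) (sym (+-assoc (g x) (∑ xs g) (∑ ys g)))

∑-map : (xs : List A) (h : A → B) (g : B → ℕ) → ∑ (map h xs) g ≡ ∑[ x ∈ xs ] g (h x)
∑-map []       h g = refl
∑-map (x ∷ xs) h g = cong (g (h x) +_) (∑-map xs h g)

differ : Bool → Bool → ℕ
differ false false = 0
differ false true  = 1
differ true  false = 1
differ true  true  = 0

length-filter-≢ : (xs : List A) (a b : A → Bool)
                → length (filter (λ x → ¬? (a x ≟ᵇ b x)) xs) ≡ ∑[ x ∈ xs ] differ (a x) (b x)
length-filter-≢ []       a b = refl
length-filter-≢ (x ∷ xs) a b with a x | b x
... | false | false = length-filter-≢ xs a b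
... | false | true  = cong suc (length-filter-≢ xs a b)
... | true  | false = cong suc (length-filter-≢ xs a b)
... | true  | true  = length-filter-≢ xs a b

∑-allSwaps-suc : (g : Swap (suc m) → ℕ)
               → ∑ (allSwaps (suc m)) g
               ≡ ∑[ x ∈ allSwaps m ] g (false ∷ x) + ∑[ x ∈ allSwaps m ] g (true ∷ x)
∑-allSwaps-suc {m} g =
  trans (∑-++ (map (false ∷_) (allSwaps m)) (map (true ∷_) (allSwaps m)) g)
        (cong₂ _+_ (∑-map (allSwaps m) (false ∷_) g) (∑-map (allSwaps m) (true ∷_) g))

indicator : {P : Set} → Dec P → ℕ
indicator p = if does p then 1 else 0

indicator-cong : {P Q : Set} (p : Dec P) (q : Dec Q) → (P → Q) → (Q → P) → indicator p ≡ indicator q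
indicator-cong (yes _) (yes _) _   _   = refl
indicator-cong (yes p) (no ¬q) p→q _   = ⊥-elim (¬q (p→q p))
indicator-cong (no ¬p) (yes q) _   q→p = ⊥-elim (¬p (q→p q))
indicator-cong (no _)  (no _)  _   _   = refl

-- Defined through 'does' so that it computes on heads: δ (b ∷ w) (b ∷ v) = δ w v.
δ : Vec Bool m → Vec Bool m → ℕ
δ w v = indicator (≡-dec _≟ᵇ_ w v)

∑-δ : (w : Swap m) (g : Swap m → ℕ) → ∑[ v ∈ allSwaps m ] (δ w v * g v) ≡ g w
∑-δ []           g = trans (+-identityʳ _) (+-identityʳ (g []))
∑-δ {suc m} (false ∷ w) g =
  trans (∑-allSwaps-suc (λ v → δ (false ∷ w) v * g v))
        (trans (cong₂ _+_ (∑-δ w (λ v → g (false ∷ v))) (∑-zero (allSwaps m))) (+-identityʳ _))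
∑-δ {suc m} (true ∷ w) g =
  trans (∑-allSwaps-suc (λ v → δ (true ∷ w) v * g v))
        (cong₂ _+_ (∑-zero (allSwaps m)) (∑-δ w (λ v → g (true ∷ v))))

∑-reindex : (h : Swap m → Swap t)
          → ((v : Swap t) → Σ (Swap m) (λ x → h x ≡ v × ((y : Swap m) → h y ≡ v → y ≡ x)))
          → (g : Swap t → ℕ) → ∑[ x ∈ allSwaps m ] g (h x) ≡ ∑[ v ∈ allSwaps t ] g v
∑-reindex {m} {t} h unique g = begin
  ∑[ x ∈ allSwaps m ] g (h x)
    ≡⟨ ∑-cong (allSwaps m) (λ x → sym (∑-δ (h x) g)) ⟩
  ∑[ x ∈ allSwaps m ] ∑[ v ∈ allSwaps t ] (δ (h x) v * g v)
    ≡⟨ ∑-comm (allSwaps m) (allSwaps t) (λ x v → δ (h x) v * g v) ⟩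
  ∑[ v ∈ allSwaps t ] ∑[ x ∈ allSwaps m ] (δ (h x) v * g v)
    ≡⟨ ∑-cong (allSwaps t) (λ v → ∑-distribʳ-* (allSwaps m) (λ x → δ (h x) v) (g v)) ⟩
  ∑[ v ∈ allSwaps t ] (∑[ x ∈ allSwaps m ] δ (h x) v * g v)
    ≡⟨ ∑-cong (allSwaps t) (λ v → trans (cong (_* g v) (preimages v)) (*-identityˡ (g v))) ⟩
  ∑[ v ∈ allSwaps t ] g v ∎
  where
  preimages : (v : Swap t) → ∑[ x ∈ allSwaps m ] δ (h x) v ≡ 1
  preimages v with unique v
  ... | x₀ , hx₀≡v , x₀-unique = begin
    ∑[ x ∈ allSwaps m ] δ (h x) v
      ≡⟨ ∑-cong (allSwaps m) (λ x → indicator-cong (≡-dec _≟ᵇ_ (h x) v) (≡-dec _≟ᵇ_ x₀ x)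
                                       (λ hx≡v → sym (x₀-unique x hx≡v)) (λ { refl → hx₀≡v })) ⟩
    ∑[ x ∈ allSwaps m ] δ x₀ x
      ≡⟨ ∑-cong (allSwaps m) (λ x → sym (*-identityʳ (δ x₀ x))) ⟩
    ∑[ x ∈ allSwaps m ] (δ x₀ x * 1)
      ≡⟨ ∑-δ x₀ (λ _ → 1) ⟩
    1 ∎

mismatches : Bool → Vec Bool t → ℕ
mismatches b []      = 0
mismatches b (c ∷ v) = differ b c + mismatches b v

f≡∑mismatches : (T : Instance m t) (N : CPT m)
              → f T N ≡ ∑[ x ∈ allSwaps m ] mismatches (vote N x) (config T x)
f≡∑mismatches {m} []       N = sym (∑-zero (allSwaps m))
f≡∑mismatches {m} (Nₛ ∷ T) N =
  trans (cong₂ _+_ (length-filter-≢ (allSwaps m) (vote N) (vote Nₛ)) (f≡∑mismatches T N))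
        (sym (∑-distrib-+ (allSwaps m) (λ x → differ (vote N x) (vote Nₛ x))
                                       (λ x → mismatches (vote N x) (config T x))))

ones : Vec Bool t → ℕ
ones []          = 0
ones (false ∷ v) = ones v
ones (true  ∷ v) = suc (ones v)

mismatches-false : (v : Vec Bool t) → mismatches false v ≡ ones v
mismatches-false []          = refl
mismatches-false (false ∷ v) = mismatches-false v
mismatches-false (true  ∷ v) = cong suc (mismatches-false v)

mismatches-true+ones : (v : Vec Bool t) → mismatches true v + ones v ≡ t
mismatches-true+ones []          = refl
mismatches-true+ones (false ∷ v) = cong suc (mismatches-true+ones v)
mismatches-true+ones (true  ∷ v) =
  trans (+-suc (mismatches true v) (ones v)) (cong suc (mismatches-true+ones v))

mismatches-true : (v : Vec Bool t) → mismatches true v ≡ t ∸ ones v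
mismatches-true v =
  trans (sym (m+n∸n≡m (mismatches true v) (ones v))) (cong (_∸ ones v) (mismatches-true+ones v))

minority : ℕ → ℕ → ℕ
minority t k = k ⊓ (t ∸ k)

minority≤mismatches : (b : Bool) (v : Vec Bool t) → minority t (ones v) ≤ mismatches b v
minority≤mismatches {t} false v =
  subst (minority t (ones v) ≤_) (sym (mismatches-false v)) (m⊓n≤m (ones v) (t ∸ ones v))
minority≤mismatches {t} true v =
  subst (minority t (ones v) ≤_) (sym (mismatches-true v)) (m⊓n≤n (ones v) (t ∸ ones v))

majority : Vec Bool t → Bool
majority {t} v with ones v ≤? t ∸ ones v
... | yes _ = false
... | no  _ = true

mismatches-majority : (v : Vec Bool t) → mismatches (majority v) v ≡ minority t (ones v)
mismatches-majority {t} v with ones v ≤? t ∸ ones v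
... | yes k≤t∸k = trans (mismatches-false v) (sym (m≤n⇒m⊓n≡m k≤t∸k))
... | no  k≰t∸k = trans (mismatches-true v) (sym (m≥n⇒m⊓n≡n (<⇒≤ (≰⇒> k≰t∸k))))

majorityCPT : Instance m t → CPT m
majorityCPT T = record
  { parents = ⊤
  ; rule    = λ γ → majority (config T (tabulate (λ i → γ i ∈⊤)))
  }

vote-majorityCPT : (T : Instance m t) (x : Swap m) → vote (majorityCPT T) x ≡ majority (config T x)
vote-majorityCPT T x = cong (λ y → majority (config T y)) (tabulate∘lookup x)

f-optimal : (T : Instance m t) (N : CPT m) → Optimal T N
          → f T N ≡ ∑[ x ∈ allSwaps m ] minority t (ones (config T x))
f-optimal {m} {t} T N optimal = ≤-antisym (subst (f T N ≤_) f-majority (optimal (majorityCPT T))) lower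
  where
  f-majority : f T (majorityCPT T) ≡ ∑[ x ∈ allSwaps m ] minority t (ones (config T x))
  f-majority = trans (f≡∑mismatches T (majorityCPT T)) (∑-cong (allSwaps m) λ x →
    trans (cong (λ b → mismatches b (config T x)) (vote-majorityCPT T x))
          (mismatches-majority (config T x)))
  lower : ∑[ x ∈ allSwaps m ] minority t (ones (config T x)) ≤ f T N
  lower = subst (_ ≤_) (sym (f≡∑mismatches T N))
    (∑-mono-≤ (allSwaps m) (λ x → minority≤mismatches (vote N x) (config T x)))

∑< : ℕ → (ℕ → ℕ) → ℕ
∑< zero    h = 0
∑< (suc n) h = h 0 + ∑< n (λ i → h (suc i))

syntax ∑< n (λ i → e) = ∑[ i < n ] e

∑<-cong : (n : ℕ) {g h : ℕ → ℕ} → (∀ i → i < n → g i ≡ h i) → ∑< n g ≡ ∑< n h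
∑<-cong zero    g≡h = refl
∑<-cong (suc n) g≡h = cong₂ _+_ (g≡h 0 (s≤s z≤n)) (∑<-cong n (λ i i<n → g≡h (suc i) (s≤s i<n)))

∑<-distrib-+ : (n : ℕ) (g h : ℕ → ℕ) → ∑[ i < n ] (g i + h i) ≡ ∑< n g + ∑< n h
∑<-distrib-+ zero    g h = refl
∑<-distrib-+ (suc n) g h =
  trans (cong (g 0 + h 0 +_) (∑<-distrib-+ n _ _)) (interchange (g 0) (h 0) (∑< n _) (∑< n _))

∑<-suc : (n : ℕ) (h : ℕ → ℕ) → ∑< (suc n) h ≡ ∑< n h + h n
∑<-suc zero    h = +-identityʳ (h 0)
∑<-suc (suc n) h = trans (cong (h 0 +_) (∑<-suc n (λ i → h (suc i)))) (sym (+-assoc (h 0) _ _))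

∑<-+ : (a b : ℕ) (h : ℕ → ℕ) → ∑< (a + b) h ≡ ∑< a h + ∑[ i < b ] h (a + i)
∑<-+ zero    b h = refl
∑<-+ (suc a) b h = trans (cong (h 0 +_) (∑<-+ a b (λ i → h (suc i)))) (sym (+-assoc (h 0) _ _))

∑<-reverse : (n : ℕ) (h : ℕ → ℕ) → ∑< n h ≡ ∑[ i < n ] h (n ∸ suc i)
∑<-reverse zero    h = refl
∑<-reverse (suc n) h = begin
  ∑< (suc n) h                       ≡⟨ ∑<-suc n h ⟩
  ∑< n h + h n                       ≡⟨ cong (_+ h n) (∑<-reverse n h) ⟩
  ∑[ i < n ] h (n ∸ suc i) + h n     ≡⟨ +-comm _ (h n) ⟩
  ∑[ i < suc n ] h (suc n ∸ suc i)   ∎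

sum-applyUpTo : (n : ℕ) (g h : ℕ → ℕ) → sum (map g (applyUpTo h n)) ≡ ∑[ i < n ] g (h i)
sum-applyUpTo zero    g h = refl
sum-applyUpTo (suc n) g h = cong (g (h 0) +_) (sum-applyUpTo n g (λ i → h (suc i)))

binomialSum : ℕ → (ℕ → ℕ) → ℕ
binomialSum t h = ∑[ k < suc t ] ((t C k) * h k)

binomialSum-suc : (t : ℕ) (h : ℕ → ℕ) → binomialSum (suc t) h ≡ binomialSum t h + binomialSum t (λ k → h (suc k))
binomialSum-suc t h = begin
  1 * h 0 + ∑[ k < suc t ] ((suc t C suc k) * h (suc k))
    ≡⟨ cong (1 * h 0 +_) (∑<-cong (suc t) λ k _ →
         trans (cong (_* h (suc k)) (sym (nCk+nC[k+1]≡[n+1]C[k+1] t k)))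
               (*-distribʳ-+ (h (suc k)) (t C k) (t C suc k))) ⟩
  1 * h 0 + ∑[ k < suc t ] ((t C k) * h (suc k) + (t C suc k) * h (suc k))
    ≡⟨ cong (1 * h 0 +_) (∑<-distrib-+ (suc t) (λ k → (t C k) * h (suc k)) (λ k → (t C suc k) * h (suc k))) ⟩
  1 * h 0 + (binomialSum t (λ k → h (suc k)) + ∑[ k < suc t ] ((t C suc k) * h (suc k)))
    ≡⟨ cong (1 * h 0 +_) (+-comm (binomialSum t (λ k → h (suc k))) (∑[ k < suc t ] ((t C suc k) * h (suc k)))) ⟩
  1 * h 0 + (∑[ k < suc t ] ((t C suc k) * h (suc k)) + binomialSum t (λ k → h (suc k)))
    ≡⟨ sym (+-assoc (1 * h 0) _ _) ⟩
  1 * h 0 + ∑[ k < suc t ] ((t C suc k) * h (suc k)) + binomialSum t (λ k → h (suc k))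
    ≡⟨ cong (λ s → 1 * h 0 + s + binomialSum t (λ k → h (suc k))) top-vanishes ⟩
  binomialSum t h + binomialSum t (λ k → h (suc k)) ∎
  where
  top-vanishes : ∑[ k < suc t ] ((t C suc k) * h (suc k)) ≡ ∑[ k < t ] ((t C suc k) * h (suc k))
  top-vanishes = begin
    ∑[ k < suc t ] ((t C suc k) * h (suc k))
      ≡⟨ ∑<-suc t _ ⟩
    ∑[ k < t ] ((t C suc k) * h (suc k)) + (t C suc t) * h (suc t)
      ≡⟨ cong (λ c → ∑[ k < t ] ((t C suc k) * h (suc k)) + c * h (suc t)) (k>n⇒nCk≡0 (n<1+n t)) ⟩
    ∑[ k < t ] ((t C suc k) * h (suc k)) + 0
      ≡⟨ +-identityʳ _ ⟩
    ∑[ k < t ] ((t C suc k) * h (suc k)) ∎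

∑-allSwaps-ones : (t : ℕ) (h : ℕ → ℕ) → ∑[ v ∈ allSwaps t ] h (ones v) ≡ binomialSum t h
∑-allSwaps-ones zero    h = cong (_+ 0) (sym (+-identityʳ (h 0)))
∑-allSwaps-ones (suc t) h =
  trans (∑-allSwaps-suc {t} (λ v → h (ones v)))
        (trans (cong₂ _+_ (∑-allSwaps-ones t h) (∑-allSwaps-ones t (λ k → h (suc k))))
               (sym (binomialSum-suc t h)))

minorityWeight : ℕ → ℕ → ℕ
minorityWeight t k = (t C k) * minority t k

minorityWeight-low : (t j : ℕ) → j + j ≤ t → minorityWeight t j ≡ j * (t C j)
minorityWeight-low t j j+j≤t =
  trans (cong ((t C j) *_) (m≤n⇒m⊓n≡m (m+n≤o⇒m≤o∸n j j+j≤t))) (*-comm (t C j) j)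

minorityWeight-sym : (t k : ℕ) → k ≤ t → minorityWeight t (t ∸ k) ≡ minorityWeight t k
minorityWeight-sym t k k≤t = cong₂ _*_ (sym (nCk≡nC[n∸k] k≤t))
  (trans (cong ((t ∸ k) ⊓_) (m∸[m∸n]≡n k≤t)) (⊓-comm (t ∸ k) k))

minorityWeight-high : (t j : ℕ) → j + j ≤ t → minorityWeight t (t ∸ j) ≡ j * (t C j)
minorityWeight-high t j j+j≤t =
  trans (minorityWeight-sym t j (≤-trans (m≤m+n j j) j+j≤t)) (minorityWeight-low t j j+j≤t)

binomialSum-minority-odd : (t c : ℕ) → suc t ≡ c + c
                         → binomialSum t (minority t) ≡ 2 * ∑[ κ < c ] (κ * (t C κ))
binomialSum-minority-odd t c 1+t≡2c = begin
  ∑< (suc t) (minorityWeight t)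
    ≡⟨ cong (λ n → ∑< n (minorityWeight t)) 1+t≡2c ⟩
  ∑< (c + c) (minorityWeight t)
    ≡⟨ ∑<-+ c c (minorityWeight t) ⟩
  ∑< c (minorityWeight t) + ∑[ i < c ] minorityWeight t (c + i)
    ≡⟨ cong (∑< c (minorityWeight t) +_) (∑<-reverse c (λ i → minorityWeight t (c + i))) ⟩
  ∑< c (minorityWeight t) + ∑[ j < c ] minorityWeight t (c + (c ∸ suc j))
    ≡⟨ cong₂ _+_ (∑<-cong c λ j j<c → minorityWeight-low t j (bound j j<c))
                 (∑<-cong c λ j j<c → trans (cong (minorityWeight t) (mirror j j<c))
                                            (minorityWeight-high t j (bound j j<c))) ⟩
  X + X
    ≡⟨ cong (X +_) (sym (+-identityʳ X)) ⟩
  2 * X ∎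
  where
  X = ∑[ κ < c ] (κ * (t C κ))
  bound : (j : ℕ) → j < c → j + j ≤ t
  bound j j<c = s≤s⁻¹ (subst (suc (j + j) ≤_) (sym 1+t≡2c) (+-mono-< j<c j<c))
  mirror : (j : ℕ) → j < c → c + (c ∸ suc j) ≡ t ∸ j
  mirror j j<c = trans (sym (+-∸-assoc c j<c)) (cong (_∸ suc j) (sym 1+t≡2c))

binomialSum-minority-even : (t c : ℕ) → t ≡ c + c
                          → binomialSum t (minority t) ≡ 2 * ∑[ κ < c ] (κ * (t C κ)) + c * (t C c)
binomialSum-minority-even t c t≡2c = begin
  ∑< (suc t) (minorityWeight t)
    ≡⟨ cong (λ n → ∑< n (minorityWeight t)) (trans (cong suc t≡2c) (sym (+-suc c c))) ⟩
  ∑< (c + suc c) (minorityWeight t)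
    ≡⟨ ∑<-+ c (suc c) (minorityWeight t) ⟩
  ∑< c (minorityWeight t) + (minorityWeight t (c + 0) + ∑[ i < c ] minorityWeight t (c + suc i))
    ≡⟨ cong (λ s → ∑< c (minorityWeight t) + (minorityWeight t (c + 0) + s))
            (∑<-reverse c (λ i → minorityWeight t (c + suc i))) ⟩
  ∑< c (minorityWeight t) + (minorityWeight t (c + 0) + ∑[ j < c ] minorityWeight t (c + suc (c ∸ suc j)))
    ≡⟨ cong₂ _+_ (∑<-cong c λ j j<c → minorityWeight-low t j (bound j j<c))
         (cong₂ _+_ middle (∑<-cong c λ j j<c → trans (cong (minorityWeight t) (mirror j j<c))
                                                      (minorityWeight-high t j (bound j j<c)))) ⟩
  X + (Y + X)
    ≡⟨ cong (X +_) (+-comm Y X) ⟩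
  X + (X + Y)
    ≡⟨ sym (+-assoc X X Y) ⟩
  X + X + Y
    ≡⟨ cong (λ s → X + s + Y) (sym (+-identityʳ X)) ⟩
  2 * X + Y ∎
  where
  X = ∑[ κ < c ] (κ * (t C κ))
  Y = c * (t C c)
  bound : (j : ℕ) → j < c → j + j ≤ t
  bound j j<c = subst (j + j ≤_) (sym t≡2c) (+-mono-≤ (<⇒≤ j<c) (<⇒≤ j<c))
  mirror : (j : ℕ) → j < c → c + suc (c ∸ suc j) ≡ t ∸ j
  mirror j j<c = trans (cong (c +_) (sym (+-∸-assoc 1 j<c)))
                       (trans (sym (+-∸-assoc c (<⇒≤ j<c))) (cong (_∸ j) (sym t≡2c)))
  middle : minorityWeight t (c + 0) ≡ Y
  middle = trans (cong (minorityWeight t) (+-identityʳ c))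
                 (minorityWeight-low t c (subst (c + c ≤_) (sym t≡2c) ≤-refl))

lemma7 : (m t : ℕ) (T : Instance m t) (N : CPT m)
    → ((v : Vec Bool t) → Σ (Swap m) (λ x → config T x ≡ v × ((y : Swap m) → config T y ≡ v → y ≡ x)))
    → Optimal T N
    → ((c : ℕ) → t + 1 ≡ 2 * c
    → f T N ≡ 2 * sum (map (λ κ → κ * ((2 * c ∸ 1) C κ)) (upTo c)))
    × ((c : ℕ) → t ≡ 2 * c
    → f T N ≡ 2 * sum (map (λ κ → κ * ((2 * c) C κ)) (upTo c)) + c * ((2 * c) C c))
lemma7 m t T N unique optimal = odd , even
  where
  f≡binomialSum : f T N ≡ binomialSum t (minority t)
  f≡binomialSum = begin
    f T N                                                ≡⟨ f-optimal T N optimal ⟩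
    ∑[ x ∈ allSwaps m ] minority t (ones (config T x))   ≡⟨ ∑-reindex (config T) unique (λ v → minority t (ones v)) ⟩
    ∑[ v ∈ allSwaps t ] minority t (ones v)              ≡⟨ ∑-allSwaps-ones t (minority t) ⟩
    binomialSum t (minority t)                           ∎
  halfSum : (c : ℕ) → sum (map (λ κ → κ * (t C κ)) (upTo c)) ≡ ∑[ κ < c ] (κ * (t C κ))
  halfSum c = sum-applyUpTo c (λ κ → κ * (t C κ)) (λ i → i)
  odd : (c : ℕ) → t + 1 ≡ 2 * c → f T N ≡ 2 * sum (map (λ κ → κ * ((2 * c ∸ 1) C κ)) (upTo c))
  odd c t+1≡2c rewrite trans (cong (_∸ 1) (sym t+1≡2c)) (m+n∸n≡m t 1) =
    trans f≡binomialSum (trans (binomialSum-minority-odd t c 1+t≡c+c) (cong (2 *_) (sym (halfSum c))))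
    where
    1+t≡c+c : suc t ≡ c + c
    1+t≡c+c = trans (+-comm 1 t) (trans t+1≡2c (cong (c +_) (+-identityʳ c)))
  even : (c : ℕ) → t ≡ 2 * c → f T N ≡ 2 * sum (map (λ κ → κ * ((2 * c) C κ)) (upTo c)) + c * ((2 * c) C c)
  even c t≡2c rewrite sym t≡2c =
    trans f≡binomialSum (trans (binomialSum-minority-even t c (trans t≡2c (cong (c +_) (+-identityʳ c))))
                               (cong (λ s → 2 * s + c * (t C c)) (sym (halfSum c))))
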